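{- Let $P$, $Q$, $R$ be dMTSs over a common alphabet $A$, such that $R$ has a state set disjoint from those of $P$ and of $Q$, and let $p\in P$, $q\in Q$, $r\in R$. If $p\sqsubseteq_{\mathrm{dMTS}} q$, then $p\vee r\sqsubseteq_{\mathrm{dMTS}} q\vee r$.
   Context: A disjunctive Modal Transition System (dMTS) is a tuple $(P,A,\longrightarrow_P,\dashrightarrow_P)$ with $P$ a set of states, $A$ an alphabet not containing the silent action $\tau$, a must-transition relation $\longrightarrow_P\subseteq P\times A\times(2^P\setminus\{\emptyset\})$ and a may-transition relation $\dashrightarrow_P\subseteq P\times(A\cup\{\tau\})\times P$, satisfying syntactic consistency: $p\xrightarrow{a}P'$ (must) implies $p\stackrel{a}{\dashrightarrow}p'$ (may) for all $p'\in P'$. Weak may-transitions: $p\stackrel{\epsilon}{\Longrightarrow}p'$ iff $p(\stackrel{\tau}{\dashrightarrow})^*p'$; for $\alpha\in A\cup\{\tau\}$, $p\stackrel{\alpha}{\Longrightarrow}p'$ iff there is $p''$ with $p\stackrel{\epsilon}{\Longrightarrow}p''\stackrel{\alpha}{\dashrightarrow}p'$. $\hat\alpha=\epsilon$ if $\alpha=\tau$, else $\hat\alpha=\alpha$. For dMTSs $P,Q$ over $A$, $\mathcal R\subseteq P\times Q$ is an observational modal refinement relation if for all $(p,q)\in\mathcal R$: (i) $q\xrightarrow{a}Q'$ implies there is $P'$ with $p\xrightarrow{a}P'$ and for every $p'\in P'$ some $q'\in Q'$ with $(p',q')\in\mathcal R$; (ii) $p\stackrel{\alpha}{\dashrightarrow}p'$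 implies there is $q'$ with $q\stackrel{\hat\alpha}{\Longrightarrow}q'$ and $(p',q')\in\mathcal R$. $p\sqsubseteq_{\mathrm{dMTS}}q$ iff some such relation contains $(p,q)$. dMTS-disjunction: for dMTSs $P,Q$ over $A$ with disjoint state sets, $P\vee Q$ has state set $\{p\vee q: p\in P,q\in Q\}\cup P\cup Q$, alphabet $A$, and the least must- and may-transition relations containing those of $P$ and $Q$ and satisfying: (Must) $p\vee q\xrightarrow{a}P'\cup Q'$ if $p\xrightarrow{a}_PP'$ and $q\xrightarrow{a}_QQ'$; (May1) $p\vee q\stackrel{\alpha}{\dashrightarrow}p'$ if $p\stackrel{\alpha}{\dashrightarrow}_Pp'$; (May2) $p\vee q\stackrel{\alpha}{\dashrightarrow}q'$ if $q\stackrel{\alpha}{\dashrightarrow}_Qq'$. -}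

module Defs where

open import Data.Product using (Σ; ∃; ∃-syntax; _×_; _,_)
open import Data.Empty using (⊥)
open import Relation.Binary.Construct.Closure.ReflexiveTransitive using (Star)

data Act (A : Set) : Set where
  act : A → Act A
  τ   : Act A

record dMTS (A : Set) : Set₂ where
  field
    State : Set
    must  : State → A → (State → Set) → Set₁
    may   : State → Act A → State → Set
    must-nonempty : ∀ {p a P'} → must p a P' → ∃[ p' ] P' p'
    consistent : ∀ {p a P'} → must p a P' → ∀ {p'} → P' p' → may p (act a) p'

module _ {A : Set} (P : dMTS A) where
  open dMTS P

  weakε : State → State → Set
  weakε = Star (λ x y → may x τ y)

  weak : State → Act A → State → Set
  weak p α p' = ∃[ p'' ] (weakε p p'' × may p'' α p')

  weakHat : State → Act A → State → Set
  weakHat p τ       p' = weakε p p'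
  weakHat p (act a) p' = weak p (act a) p'

IsRefinement : {A : Set} (P Q : dMTS A) →
               (dMTS.State P → dMTS.State Q → Set) → Set₁
IsRefinement {A} P Q R =
  ∀ {p q} → R p q →
    (∀ {a Q'} → dMTS.must Q q a Q' →
       ∃[ P' ] (dMTS.must P p a P' ×
                (∀ {p'} → P' p' → ∃[ q' ] (Q' q' × R p' q'))))
    ×
    (∀ {α p'} → dMTS.may P p α p' →
       ∃[ q' ] (weakHat Q q α q' × R p' q'))

Refines : {A : Set} (P Q : dMTS A) → dMTS.State P → dMTS.State Q → Set₁
Refines P Q p q = ∃[ R ] (IsRefinement P Q R × R p q)

-- dMTS-disjunction.  The state set {p ∨ q} ∪ P ∪ Q is a tagged (hence
-- disjoint) union.
module Disj {A : Set} (P Q : dMTS A) where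
  private
    module P = dMTS P
    module Q = dMTS Q

  data DState : Set where
    _∨ₛ_ : P.State → Q.State → DState
    inP  : P.State → DState
    inQ  : Q.State → DState

  liftP : (P.State → Set) → DState → Set
  liftP P' (inP x) = P' x
  liftP P' _       = ⊥

  liftQ : (Q.State → Set) → DState → Set
  liftQ Q' (inQ x) = Q' x
  liftQ Q' _       = ⊥

  union : (P.State → Set) → (Q.State → Set) → DState → Set
  union P' Q' (inP x) = P' x
  union P' Q' (inQ x) = Q' x
  union P' Q' (_ ∨ₛ _) = ⊥

  data Must : DState → A → (DState → Set) → Set₁ where
    must∨ : ∀ {p q a P' Q'} → P.must p a P' → Q.must q a Q' →
            Must (p ∨ₛ q) a (union P' Q')
    mustP : ∀ {p a P'} → P.must p a P' → Must (inP p) a (liftP P')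
    mustQ : ∀ {q a Q'} → Q.must q a Q' → Must (inQ q) a (liftQ Q')

  data May : DState → Act A → DState → Set where
    may1 : ∀ {p q α p'} → P.may p α p' → May (p ∨ₛ q) α (inP p')
    may2 : ∀ {p q α q'} → Q.may q α q' → May (p ∨ₛ q) α (inQ q')
    mayP : ∀ {p α p'} → P.may p α p' → May (inP p) α (inP p')
    mayQ : ∀ {q α q'} → Q.may q α q' → May (inQ q) α (inQ q')

  nonempty : ∀ {s a S'} → Must s a S' → ∃[ s' ] S' s'
  nonempty (must∨ m _) with P.must-nonempty m
  ... | x , px = inP x , px
  nonempty (mustP m) with P.must-nonempty m
  ... | x , px = inP x , px
  nonempty (mustQ m) with Q.must-nonempty m
  ... | x , qx = inQ x , qx

  consistent : ∀ {s a S'} → Must s a S' → ∀ {s'} → S' s' → May s (act a) s'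
  consistent (must∨ m n) {inP x} h = may1 (P.consistent m h)
  consistent (must∨ m n) {inQ x} h = may2 (Q.consistent n h)
  consistent (mustP m) {inP x} h = mayP (P.consistent m h)
  consistent (mustQ m) {inQ x} h = mayQ (Q.consistent m h)

  dmts : dMTS A
  dmts = record
    { State = DState ; must = Must ; may = May
    ; must-nonempty = nonempty ; consistent = consistent }

_∨ᵈ_ : {A : Set} → dMTS A → dMTS A → dMTS A
P ∨ᵈ Q = Disj.dmts P Q

module Submission where

-- The witnessing relation pairs p ∨ r with q ∨ r, the P-copy of p with the
-- Q-copy of q, the two R-copies of r with each other, and, in addition, the
-- P-copy of p with q ∨ r.  The last pairs are needed because a weak move of
-- q lifts to q ∨ r and lands in the Q-copy, except for the empty τ-move,
-- which stays at q ∨ r itself.  Must-transitions of q ∨ r and of the Q-copy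
-- of q both come from must-transitions of q, so they are matched by the
-- must-transitions that p ∨ r and the P-copy of p inherit from p.

open import Defs
open import Data.Product using (∃-syntax; _×_; _,_; proj₁; proj₂)
open import Relation.Binary.Construct.Closure.ReflexiveTransitive using (ε; _◅_)

may⇒weakHat : {A : Set} (T : dMTS A) {t t' : dMTS.State T} {α : Act A} →
              dMTS.may T t α t' → weakHat T t α t'
may⇒weakHat T {α = τ}     m = m ◅ ε
may⇒weakHat T {α = act a} m = _ , ε , m

module _ {A : Set} (Q R : dMTS A) where
  private
    module Q = dMTS Q
  open Disj Q R

  data Face : DState → Q.State → Set where
    copy-face : ∀ {q} → Face (inP q) q
    join-face : ∀ {q r} → Face (q ∨ₛ r) q

  face-may : ∀ {y q α q'} → Face y q → Q.may q α q' → May y α (inP q')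
  face-may copy-face m = mayP m
  face-may join-face m = may1 m

  face-must⁻¹ : ∀ {y q a U} → Face y q → Must y a U →
                ∃[ Q' ] (Q.must q a Q' × (∀ {q'} → Q' q' → U (inP q')))
  face-must⁻¹ copy-face (mustP m)   = _ , m , λ h → h
  face-must⁻¹ join-face (must∨ m _) = _ , m , λ h → h

  face-weakε : ∀ {y q q'} → Face y q → weakε Q q q' →
               ∃[ y' ] (weakε (Q ∨ᵈ R) y y' × Face y' q')
  face-weakε f ε       = _ , ε , f
  face-weakε f (m ◅ s) with face-weakε copy-face s
  ... | y' , s' , f' = y' , face-may f m ◅ s' , f'

  face-weakHat : ∀ {y q α q'} → Face y q → weakHat Q q α q' →
                 ∃[ y' ] (weakHat (Q ∨ᵈ R) y α y' × Face y' q')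
  face-weakHat {α = τ}     f s = face-weakε f s
  face-weakHat {α = act a} f (_ , s , m) with face-weakε f s
  ... | y' , s' , f' = inP _ , (y' , s' , face-may f' m) , copy-face

module ∨-Refinement {A : Set} (P Q R : dMTS A)
                    (_≼_ : dMTS.State P → dMTS.State Q → Set)
                    (≼-refinement : IsRefinement P Q _≼_) where
  private
    module PR = Disj P R
    module QR = Disj Q R

  data _≼∨_ : PR.DState → QR.DState → Set where
    join  : ∀ {p q r} → p ≼ q → (p PR.∨ₛ r) ≼∨ (q QR.∨ₛ r)
    left  : ∀ {p q y} → p ≼ q → Face Q R y q → PR.inP p ≼∨ y
    right : ∀ {r} → PR.inQ r ≼∨ QR.inQ r

  left-may : ∀ {p q y α p'} → p ≼ q → Face Q R y q → dMTS.may P p α p' →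
             ∃[ y' ] (weakHat (Q ∨ᵈ R) y α y' × PR.inP p' ≼∨ y')
  left-may pq f m with proj₂ (≼-refinement pq) m
  ... | _ , w , p'q' with face-weakHat Q R f w
  ...   | y' , w' , f' = y' , w' , left p'q' f'

  Matched : (PR.DState → Set) → (QR.DState → Set) → Set
  Matched T U = ∀ {x} → T x → ∃[ y ] (U y × x ≼∨ y)

  MustMatched : PR.DState → QR.DState → Set₁
  MustMatched x y = ∀ {a U} → QR.Must y a U → ∃[ T ] (PR.Must x a T × Matched T U)

  MayMatched : PR.DState → QR.DState → Set
  MayMatched x y = ∀ {α x'} → PR.May x α x' → ∃[ y' ] (weakHat (Q ∨ᵈ R) y α y' × x' ≼∨ y')

  ≼∨-refinement : IsRefinement (P ∨ᵈ R) (Q ∨ᵈ R) _≼∨_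
  ≼∨-refinement (join pq) = must , may
    where
    must : MustMatched _ _
    must (QR.must∨ mq mr) with proj₁ (≼-refinement pq) mq
    ... | _ , mp , match = _ , PR.must∨ mp mr , target
      where
      target : Matched (PR.union _ _) (QR.union _ _)
      target {PR.inP _} h with match h
      ... | q' , hq' , p'q' = QR.inP q' , hq' , left p'q' copy-face
      target {PR.inQ r'} h = QR.inQ r' , h , right
    may : MayMatched _ _
    may (PR.may1 m) = left-may pq join-face m
    may (PR.may2 m) = _ , may⇒weakHat (Q ∨ᵈ R) (QR.may2 m) , right
  ≼∨-refinement (left pq f) = must , may
    where
    must : MustMatched _ _
    must {U = U} m with face-must⁻¹ Q R f m
    ... | _ , mq , into with proj₁ (≼-refinement pq) mq
    ...   | P' , mp , match = _ , PR.mustP mp , target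
      where
      target : Matched (PR.liftP P') U
      target {PR.inP _} h with match h
      ... | q' , hq' , p'q' = QR.inP q' , into hq' , left p'q' copy-face
    may : MayMatched _ _
    may (PR.mayP m) = left-may pq f m
  ≼∨-refinement right = must , may
    where
    must : MustMatched _ _
    must (QR.mustQ {Q' = R'} m) = _ , PR.mustQ m , target
      where
      target : Matched (PR.liftQ R') (QR.liftQ R')
      target {PR.inQ r'} h = QR.inQ r' , h , right
    may : MayMatched _ _
    may (PR.mayQ m) = _ , may⇒weakHat (Q ∨ᵈ R) (QR.mayQ m) , right

corollary3p11 : {A : Set} (P Q R : dMTS A)
    (p : dMTS.State P) (q : dMTS.State Q) (r : dMTS.State R) →
    Refines P Q p q →
    Refines (P ∨ᵈ R) (Q ∨ᵈ R) (Disj._∨ₛ_ p r) (Disj._∨ₛ_ q r)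
corollary3p11 P Q R p q r (_≼_ , ≼-refinement , p≼q) =
  _≼∨_ , ≼∨-refinement , join p≼q
  where open ∨-Refinement P Q R _≼_ ≼-refinement
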